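{- Let $v,w\in S_n$. The pair $(v,w)$ is divisible if and only if $v^{ -1}w$ is not Boolean.
   Context: For $u=u_1\dots u_n\in S_n$ (one-line notation) and $1\le a\le b\le n$, $u[a,b]=\{u_a,\dots,u_b\}$. The pair $(v,w)$ is \emph{divisible after position $i$} if $|v[1,i]\cap w[1,i]|\le i-2$, and \emph{divisible at position $i$} if $v_i=w_i$ and $|v[1,i]\cap w[1,i]|\le i-1$. The pair is \emph{divisible} if there is $1\le i\le n$ such that it is divisible at or after position $i$. A permutation is \emph{Boolean} if it avoids the patterns $321$ and $3412$ (equivalently, no simple transposition $s_i=(i\ i+1)$ appears more than once in a reduced word for it). Here $u$ contains a pattern $p\in S_k$ if there are positions $i_1<\dots<i_k$ with $u_{i_1}\dots u_{i_k}$ in the same relative order as $p_1\dots p_k$, and avoids it otherwise. -}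

module Defs where

open import Data.Nat using (ℕ; zero; suc; _+_; _≤_)
open import Data.Nat.Base using (_≤ᵇ_; _≡ᵇ_)
open import Data.Bool using (Bool; true; false; _∧_; if_then_else_)
open import Data.Fin using (Fin; toℕ) renaming (_<_ to _<ᶠ_)
open import Data.List using (List; map; allFin)
open import Data.Bool.ListAction using (any)
open import Data.Nat.ListAction using (sum)
open import Data.Fin.Permutation using (Permutation′; _⟨$⟩ʳ_; _⟨$⟩ˡ_)
open import Data.Product using (∃; _×_; ∃-syntax)
open import Data.Sum using (_⊎_)
open import Relation.Nullary using (¬_)
open import Relation.Binary.PropositionalEquality using (_≡_)

-- Permutations of S_n act on positions/values Fin n = {0,…,n-1}
-- (position i of the paper, 1 ≤ i ≤ n, is the index k with toℕ k = i - 1).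
-- One-line notation: u_i is  u ⟨$⟩ʳ i.

_≡ᶠᵇ_ : ∀ {n} → Fin n → Fin n → Bool
a ≡ᶠᵇ b = toℕ a ≡ᵇ toℕ b

inPrefix : ∀ {n} → Permutation′ n → Fin n → Fin n → Bool
inPrefix {n} u k x = any (λ j → (toℕ j ≤ᵇ toℕ k) ∧ ((u ⟨$⟩ʳ j) ≡ᶠᵇ x)) (allFin n)

commonPrefix : ∀ {n} → Permutation′ n → Permutation′ n → Fin n → ℕ
commonPrefix {n} v w k =
  sum (map (λ x → if inPrefix v k x ∧ inPrefix w k x then 1 else 0) (allFin n))

DivisibleAfter : ∀ {n} → Permutation′ n → Permutation′ n → Fin n → Set
DivisibleAfter v w k = commonPrefix v w k + 2 ≤ toℕ k + 1

DivisibleAt : ∀ {n} → Permutation′ n → Permutation′ n → Fin n → Set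
DivisibleAt v w k = (v ⟨$⟩ʳ k ≡ w ⟨$⟩ʳ k) × (commonPrefix v w k + 1 ≤ toℕ k + 1)

Divisible : ∀ {n} → Permutation′ n → Permutation′ n → Set
Divisible {n} v w = ∃[ k ] (DivisibleAt v w k ⊎ DivisibleAfter v w k)

invMul : ∀ {n} → Permutation′ n → Permutation′ n → Fin n → Fin n
invMul v w i = v ⟨$⟩ˡ (w ⟨$⟩ʳ i)

Contains321 : ∀ {n} → (Fin n → Fin n) → Set
Contains321 u = ∃[ i ] ∃[ j ] ∃[ k ]
  ((i <ᶠ j) × (j <ᶠ k) × (u k <ᶠ u j) × (u j <ᶠ u i))

Contains3412 : ∀ {n} → (Fin n → Fin n) → Set
Contains3412 u = ∃[ i ] ∃[ j ] ∃[ k ] ∃[ l ]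
  ((i <ᶠ j) × (j <ᶠ k) × (k <ᶠ l) ×
   (u k <ᶠ u l) × (u l <ᶠ u i) × (u i <ᶠ u j))

Boolean : ∀ {n} → (Fin n → Fin n) → Set
Boolean u = ¬ Contains321 u × ¬ Contains3412 u

-- Write u = v⁻¹w. Reindexing by w, |v[1,i] ∩ w[1,i]| is the number of positions j ≤ i with
-- u_j ≤ i, so i minus it is the number of positions j ≤ i that u sends above i, and (u being a
-- bijection) also the number of positions j > i that u sends to at most i. Hence (v,w) is
-- divisible after i iff two entries of u cross the cut at i in each direction, and divisible at i
-- iff u_i = i and one entry crosses in each direction. Comparing the two entries crossing upwards
-- and the two crossing downwards always exhibits a 321 or a 3412; conversely, a 321 yields such a
-- cut at or next to its middle entry, and a 3412 one right after its "4" or right before its "1".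
-- Divisibility is decidable, which makes the converse constructive.
module Submission where

open import Defs
open import Data.Nat using (ℕ; zero; suc; _+_; _≤_; z≤n; s≤s; s≤s⁻¹)
import Data.Nat.Properties as ℕ
import Data.Nat.ListAction as List
open import Data.Bool using (Bool; true; false; _∧_; not; if_then_else_; T)
open import Data.Bool.Properties using (T-∧)
open import Data.Fin using (Fin; toℕ; pred)
  renaming (zero to fzero; suc to fsuc; _≤_ to _≤ᶠ_; _<_ to _<ᶠ_)
open import Data.Fin.Properties
  using (_≟_; _≤?_; _<?_; <-cmp; <⇒≢; ≤∧≢⇒<; <⇒≤pred; pred<; toℕ-injective; any?)
open import Data.Fin.Permutation
  using (Permutation′; _⟨$⟩ʳ_; _⟨$⟩ˡ_; inverseˡ; inverseʳ; flip; _∘ₚ_)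
open import Data.List using (map; tabulate; allFin)
open import Data.List.Relation.Unary.Any.Properties using (any⁺; any⁻; tabulate⁺; tabulate⁻)
open import Data.Product using (∃; ∃₂; _×_; _,_; swap)
import Data.Product as Product
open import Data.Product.Function.NonDependent.Propositional using (_×-⇔_)
open import Data.Sum using (_⊎_; inj₁; inj₂; [_,_])
open import Function.Base using (_∘_; id)
open import Function.Bundles using (_⇔_; mk⇔; Equivalence)
open import Function.Definitions using (Injective)
import Function.Properties.Equivalence as ⇔
open import Level using (Level; 0ℓ)
open import Relation.Binary.Definitions using (tri<; tri≈; tri>)
open import Relation.Binary.PropositionalEquality
  using (_≡_; refl; sym; trans; cong; cong₂; subst; module ≡-Reasoning)
open import Relation.Nullary using (¬_; Dec; does; yes; no; contradiction)
open import Relation.Nullary.Decidable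
  using (does-⇔; dec-false; T?; _×-dec_; _⊎-dec_; decidable-stable)
open import Relation.Unary using (Pred; Decidable)
open import Relation.Unary.Properties using (_∩?_; ∁?)
open import Algebra.Properties.CommutativeMonoid.Sum ℕ.+-0-commutativeMonoid
  using (sum; sum-cong-≗; ∑-distrib-+; sum-permute; sum-replicate-zero)

open Equivalence using (to; from)

private
  variable
    n : ℕ
    p q : Level

indicator : Bool → ℕ
indicator b = if b then 1 else 0

indicator-split : ∀ a b → indicator a ≡ indicator (a ∧ b) + indicator (a ∧ not b)
indicator-split true  true  = refl
indicator-split true  false = refl
indicator-split false _     = refl

count : {P : Pred (Fin n) p} → Decidable P → ℕ
count P? = sum (indicator ∘ does ∘ P?)

AtLeastTwo : Pred (Fin n) p → Set p
AtLeastTwo P = ∃₂ λ i j → i <ᶠ j × P i × P j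

module _ {P : Pred (Fin n) p} (P? : Decidable P) where

  count-cong : {Q : Pred (Fin n) q} (Q? : Decidable Q) → (∀ i → P i ⇔ Q i) → count P? ≡ count Q?
  count-cong Q? P⇔Q = sum-cong-≗ (λ i → cong indicator (does-⇔ (P⇔Q i) (P? i) (Q? i)))

  count-none : (∀ i → ¬ P i) → count P? ≡ 0
  count-none ¬P = trans (sum-cong-≗ (λ i → cong indicator (dec-false (P? i) (¬P i))))
                        (sum-replicate-zero n)

  count-permute : (π : Permutation′ n) → count (P? ∘ (π ⟨$⟩ʳ_)) ≡ count P?
  count-permute π = sym (sum-permute (indicator ∘ does ∘ P?) π)

  count-partition : {Q : Pred (Fin n) q} (Q? : Decidable Q) →
                    count P? ≡ count (P? ∩? Q?) + count (P? ∩? ∁? Q?)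
  count-partition Q? =
    trans (sum-cong-≗ (λ i → indicator-split (does (P? i)) (does (Q? i))))
          (∑-distrib-+ (indicator ∘ does ∘ (P? ∩? Q?)) (indicator ∘ does ∘ (P? ∩? ∁? Q?)))

atMost? : (k : Fin n) → Decidable {A = Fin n} (_≤ᶠ k)
atMost? k j = j ≤? k

count-atMost : (k : Fin n) → count (atMost? k) ≡ suc (toℕ k)
count-atMost {suc n} fzero    = cong suc (count-none {n} (atMost? fzero ∘ fsuc) (λ _ ()))
count-atMost {suc n} (fsuc k) =
  cong suc (trans (count-cong (atMost? (fsuc k) ∘ fsuc) (atMost? k) (λ _ → mk⇔ s≤s⁻¹ s≤s))
                  (count-atMost k))

1≤count⇒∃ : {P : Pred (Fin n) p} (P? : Decidable P) → 1 ≤ count P? → ∃ P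
1≤count⇒∃ {suc n} P? h with P? fzero
... | yes p = fzero , p
... | no _  = Product.map fsuc id (1≤count⇒∃ (P? ∘ fsuc) h)

∃⇒1≤count : {P : Pred (Fin n) p} (P? : Decidable P) → ∃ P → 1 ≤ count P?
∃⇒1≤count P? (fzero , p) with P? fzero
... | yes _ = s≤s z≤n
... | no ¬p = contradiction p ¬p
∃⇒1≤count P? (fsuc i , p) = ℕ.≤-trans (∃⇒1≤count (P? ∘ fsuc) (i , p)) (ℕ.m≤n+m _ _)

2≤count⇒atLeastTwo : {P : Pred (Fin n) p} (P? : Decidable P) → 2 ≤ count P? → AtLeastTwo P
2≤count⇒atLeastTwo {suc n} P? h with P? fzero
... | yes p = let j , pj = 1≤count⇒∃ (P? ∘ fsuc) (s≤s⁻¹ h) in fzero , fsuc j , s≤s z≤n , p , pj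
... | no _  = let i , j , i<j , pi , pj = 2≤count⇒atLeastTwo (P? ∘ fsuc) h
              in fsuc i , fsuc j , s≤s i<j , pi , pj

atLeastTwo⇒2≤count : {P : Pred (Fin n) p} (P? : Decidable P) → AtLeastTwo P → 2 ≤ count P?
atLeastTwo⇒2≤count P? (fzero , fsuc j , _ , p , pj) with P? fzero
... | yes _ = s≤s (∃⇒1≤count (P? ∘ fsuc) (j , pj))
... | no ¬p = contradiction p ¬p
atLeastTwo⇒2≤count P? (fsuc i , fsuc j , i<j , pi , pj) =
  ℕ.≤-trans (atLeastTwo⇒2≤count (P? ∘ fsuc) (i , j , s≤s⁻¹ i<j , pi , pj)) (ℕ.m≤n+m _ _)

<⇔≰ : {i j : Fin n} → i <ᶠ j ⇔ (¬ j ≤ᶠ i)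
<⇔≰ = mk⇔ ℕ.<⇒≱ ℕ.≰⇒>

module _ (u : Fin n → Fin n) (k : Fin n) where

  Keeps Leaves Enters : Pred (Fin n) 0ℓ
  Keeps  j = u j ≤ᶠ k × j ≤ᶠ k
  Leaves j = j ≤ᶠ k × k <ᶠ u j
  Enters j = u j ≤ᶠ k × k <ᶠ j

  keeps? : Decidable Keeps
  keeps? j = atMost? k (u j) ×-dec atMost? k j

  leaves? : Decidable Leaves
  leaves? j = atMost? k j ×-dec (k <? u j)

  enters? : Decidable Enters
  enters? j = atMost? k (u j) ×-dec (k <? j)

  keepers leavers entrants : ℕ
  keepers  = count keeps?
  leavers  = count leaves?
  entrants = count enters?

  keepers+leavers : keepers + leavers ≡ suc (toℕ k)
  keepers+leavers = begin
    keepers + leavers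
      ≡⟨ cong₂ _+_ (count-cong keeps? (atMost? k ∩? atMost? k ∘ u) (λ _ → mk⇔ swap swap))
                   (count-cong leaves? (atMost? k ∩? ∁? (atMost? k ∘ u)) (λ _ → ⇔.refl ×-⇔ <⇔≰)) ⟩
    count (atMost? k ∩? atMost? k ∘ u) + count (atMost? k ∩? ∁? (atMost? k ∘ u))
      ≡⟨ count-partition (atMost? k) (atMost? k ∘ u) ⟨
    count (atMost? k)
      ≡⟨ count-atMost k ⟩
    suc (toℕ k) ∎
    where open ≡-Reasoning

module _ (π : Permutation′ n) (k : Fin n) where

  private
    u : Fin n → Fin n
    u = π ⟨$⟩ʳ_

  keepers+entrants : keepers u k + entrants u k ≡ suc (toℕ k)
  keepers+entrants = begin
    keepers u k + entrants u k
      ≡⟨ cong (keepers u k +_)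
              (count-cong (enters? u k) (atMost? k ∘ u ∩? ∁? (atMost? k)) (λ _ → ⇔.refl ×-⇔ <⇔≰)) ⟩
    keepers u k + count (atMost? k ∘ u ∩? ∁? (atMost? k))
      ≡⟨ count-partition (atMost? k ∘ u) (atMost? k) ⟨
    count (atMost? k ∘ u)
      ≡⟨ count-permute (atMost? k) π ⟩
    count (atMost? k)
      ≡⟨ count-atMost k ⟩
    suc (toℕ k) ∎
    where open ≡-Reasoning

  leavers≡entrants : leavers u k ≡ entrants u k
  leavers≡entrants =
    ℕ.+-cancelˡ-≡ (keepers u k) _ _ (trans (keepers+leavers u k) (sym keepers+entrants))

module _ {u : Fin n → Fin n} (u-injective : Injective _≡_ _≡_ u) where

  private
    images-ordered : ∀ {i j} → i <ᶠ j → u j <ᶠ u i ⊎ u i <ᶠ u j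
    images-ordered {i} {j} i<j with <-cmp (u i) (u j)
    ... | tri< ui<uj _ _ = inj₂ ui<uj
    ... | tri≈ _ ui≡uj _ = contradiction (u-injective ui≡uj) (<⇒≢ i<j)
    ... | tri> _ _ uj<ui = inj₁ uj<ui

  crossings⇒321⊎3412 : ∀ {k} → AtLeastTwo (Leaves u k) → AtLeastTwo (Enters u k) →
                       Contains321 u ⊎ Contains3412 u
  crossings⇒321⊎3412 (i₁ , i₂ , i₁<i₂ , (i₁≤k , k<ui₁) , (i₂≤k , k<ui₂))
                     (j₁ , j₂ , j₁<j₂ , (uj₁≤k , k<j₁) , (uj₂≤k , k<j₂))
    with images-ordered i₁<i₂ | images-ordered j₁<j₂
  ... | inj₁ ui₂<ui₁ | _ =
    inj₁ (i₁ , i₂ , j₁ , i₁<i₂ , ℕ.≤-<-trans i₂≤k k<j₁ , ℕ.≤-<-trans uj₁≤k k<ui₂ , ui₂<ui₁)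
  ... | inj₂ _ | inj₁ uj₂<uj₁ =
    inj₁ (i₁ , j₁ , j₂ , ℕ.≤-<-trans i₁≤k k<j₁ , j₁<j₂ , uj₂<uj₁ , ℕ.≤-<-trans uj₁≤k k<ui₁)
  ... | inj₂ ui₁<ui₂ | inj₂ uj₁<uj₂ =
    inj₂ (i₁ , i₂ , j₁ , j₂ , i₁<i₂ , ℕ.≤-<-trans i₂≤k k<j₁ , j₁<j₂ ,
          uj₁<uj₂ , ℕ.≤-<-trans uj₂≤k k<ui₁ , ui₁<ui₂)

  fixedCrossing⇒321 : ∀ {k} → u k ≡ k → ∃ (Leaves u k) → ∃ (Enters u k) → Contains321 u
  fixedCrossing⇒321 {k} uk≡k (i , i≤k , k<ui) (j , uj≤k , k<j) =
    i , k , j , i<k , k<j , subst (u j <ᶠ_) (sym uk≡k) uj<k , subst (_<ᶠ u i) (sym uk≡k) k<ui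
    where
    i<k : i <ᶠ k
    i<k = ≤∧≢⇒< i≤k (λ i≡k → <⇒≢ k<ui (sym (trans (cong u i≡k) uk≡k)))
    uj<k : u j <ᶠ k
    uj<k = ≤∧≢⇒< uj≤k (λ uj≡k → <⇒≢ k<j (sym (u-injective (trans uj≡k (sym uk≡k)))))

<⇒pred< : {i j : Fin n} → i <ᶠ j → pred j <ᶠ j
<⇒pred< {j = fsuc j} _ = pred< (fsuc j) (λ ())

sum-map-tabulate : ∀ {a} {A : Set a} (f : A → ℕ) (g : Fin n → A) →
                   List.sum (map f (tabulate g)) ≡ sum (f ∘ g)
sum-map-tabulate {zero}  f g = refl
sum-map-tabulate {suc n} f g = cong (f (g fzero) +_) (sum-map-tabulate f (g ∘ fsuc))

inPrefix-correct : (u : Permutation′ n) (k x : Fin n) → inPrefix u k x ≡ does (atMost? k (u ⟨$⟩ˡ x))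
inPrefix-correct {n} u k x = does-⇔ (mk⇔ ⇒ ⇐) (T? (inPrefix u k x)) (atMost? k (u ⟨$⟩ˡ x))
  where
  ⇒ : T (inPrefix u k x) → u ⟨$⟩ˡ x ≤ᶠ k
  ⇒ t with tabulate⁻ (any⁻ _ (allFin n) t)
  ... | j , t′ with to T-∧ t′
  ...   | j≤k , uj≡x = subst (_≤ᶠ k) j≡u⁻¹x (ℕ.≤ᵇ⇒≤ _ _ j≤k)
    where
    j≡u⁻¹x : j ≡ u ⟨$⟩ˡ x
    j≡u⁻¹x = trans (sym (inverseˡ u)) (cong (u ⟨$⟩ˡ_) (toℕ-injective (ℕ.≡ᵇ⇒≡ _ _ uj≡x)))
  ⇐ : u ⟨$⟩ˡ x ≤ᶠ k → T (inPrefix u k x)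
  ⇐ u⁻¹x≤k = any⁺ _ (tabulate⁺ (u ⟨$⟩ˡ x)
                      (from T-∧ (ℕ.≤⇒≤ᵇ u⁻¹x≤k , ℕ.≡⇒≡ᵇ _ _ (cong toℕ (inverseʳ u)))))

deficit⇔ : ∀ {c a m} t → c + a ≡ m → c + t ≤ m ⇔ t ≤ a
deficit⇔ {c} t refl = mk⇔ (ℕ.+-cancelˡ-≤ c t _) (ℕ.+-monoʳ-≤ c)

module _ (v w : Permutation′ n) where

  private
    π : Permutation′ n
    π = w ∘ₚ flip v

    u : Fin n → Fin n
    u = invMul v w

    u-injective : Injective _≡_ _≡_ u
    u-injective {i} {j} ui≡uj = begin
      i                    ≡⟨ inverseˡ π ⟨
      π ⟨$⟩ˡ u i           ≡⟨ cong (π ⟨$⟩ˡ_) ui≡uj ⟩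
      π ⟨$⟩ˡ u j           ≡⟨ inverseˡ π ⟩
      j                    ∎
      where open ≡-Reasoning

  commonPrefix≡keepers : (k : Fin n) → commonPrefix v w k ≡ keepers u k
  commonPrefix≡keepers k = begin
    List.sum (map F (allFin n))  ≡⟨ sum-map-tabulate F id ⟩
    sum F                        ≡⟨ sum-permute F w ⟩
    sum (F ∘ (w ⟨$⟩ʳ_))          ≡⟨ sum-cong-≗ (cong indicator ∘ inPrefixes-correct) ⟩
    keepers u k                  ∎
    where
    open ≡-Reasoning
    F : Fin n → ℕ
    F x = indicator (inPrefix v k x ∧ inPrefix w k x)
    inPrefixes-correct : ∀ j → inPrefix v k (w ⟨$⟩ʳ j) ∧ inPrefix w k (w ⟨$⟩ʳ j)
                             ≡ does (atMost? k (u j)) ∧ does (atMost? k j)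
    inPrefixes-correct j =
      cong₂ _∧_ (inPrefix-correct v k _)
                (trans (inPrefix-correct w k _) (cong (does ∘ atMost? k) (inverseˡ w)))

  deficit⇔leavers : ∀ k t → commonPrefix v w k + t ≤ toℕ k + 1 ⇔ t ≤ leavers u k
  deficit⇔leavers k t = deficit⇔ t (begin
    commonPrefix v w k + leavers u k  ≡⟨ cong (_+ leavers u k) (commonPrefix≡keepers k) ⟩
    keepers u k + leavers u k         ≡⟨ keepers+leavers u k ⟩
    suc (toℕ k)                       ≡⟨ ℕ.+-comm 1 (toℕ k) ⟩
    toℕ k + 1                         ∎)
    where open ≡-Reasoning

  agree⇔fixed : ∀ {k} → v ⟨$⟩ʳ k ≡ w ⟨$⟩ʳ k ⇔ u k ≡ k
  agree⇔fixed {k} = mk⇔ (λ vk≡wk → trans (cong (v ⟨$⟩ˡ_) (sym vk≡wk)) (inverseˡ v))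
                        (λ uk≡k → trans (cong (v ⟨$⟩ʳ_) (sym uk≡k)) (inverseʳ v))

  divisible? : Dec (Divisible v w)
  divisible? = any? λ k → ((v ⟨$⟩ʳ k ≟ w ⟨$⟩ʳ k) ×-dec (commonPrefix v w k + 1 ℕ.≤? toℕ k + 1))
                          ⊎-dec (commonPrefix v w k + 2 ℕ.≤? toℕ k + 1)

  divisible⇒321⊎3412 : Divisible v w → Contains321 u ⊎ Contains3412 u
  divisible⇒321⊎3412 (k , inj₁ (vk≡wk , deficit)) =
    inj₁ (fixedCrossing⇒321 u-injective (to agree⇔fixed vk≡wk)
            (1≤count⇒∃ (leaves? u k) 1≤leavers)
            (1≤count⇒∃ (enters? u k) (subst (1 ≤_) (leavers≡entrants π k) 1≤leavers)))
    where
    1≤leavers : 1 ≤ leavers u k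
    1≤leavers = to (deficit⇔leavers k 1) deficit
  divisible⇒321⊎3412 (k , inj₂ deficit) =
    crossings⇒321⊎3412 u-injective
      (2≤count⇒atLeastTwo (leaves? u k) 2≤leavers)
      (2≤count⇒atLeastTwo (enters? u k) (subst (2 ≤_) (leavers≡entrants π k) 2≤leavers))
    where
    2≤leavers : 2 ≤ leavers u k
    2≤leavers = to (deficit⇔leavers k 2) deficit

  private
    twoEnter⇒divisible : ∀ {k} → AtLeastTwo (Enters u k) → Divisible v w
    twoEnter⇒divisible {k} two =
      k , inj₂ (from (deficit⇔leavers k 2)
                 (subst (2 ≤_) (sym (leavers≡entrants π k)) (atLeastTwo⇒2≤count (enters? u k) two)))

    twoLeave⇒divisible : ∀ {k} → AtLeastTwo (Leaves u k) → Divisible v w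
    twoLeave⇒divisible {k} two =
      k , inj₂ (from (deficit⇔leavers k 2) (atLeastTwo⇒2≤count (leaves? u k) two))

  321⇒divisible : Contains321 u → Divisible v w
  321⇒divisible (i , j , l , i<j , j<l , ul<uj , uj<ui) with <-cmp j (u j)
  ... | tri< j<uj _ _ =
    twoLeave⇒divisible (i , j , i<j , (ℕ.<⇒≤ i<j , ℕ.<-trans j<uj uj<ui) , (ℕ.≤-refl , j<uj))
  ... | tri≈ _ j≡uj _ =
    j , inj₁ (from agree⇔fixed (sym j≡uj) ,
              from (deficit⇔leavers j 1)
                   (∃⇒1≤count (leaves? u j) (i , ℕ.<⇒≤ i<j , subst (_<ᶠ u i) (sym j≡uj) uj<ui)))
  ... | tri> _ _ uj<j =
    twoEnter⇒divisible (j , l , j<l , (<⇒≤pred uj<j , <⇒pred< uj<j) ,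
                        (ℕ.<⇒≤ (ℕ.<-≤-trans ul<uj (<⇒≤pred uj<j)) , ℕ.<-trans (<⇒pred< uj<j) j<l))

  3412⇒divisible : Contains3412 u → Divisible v w
  3412⇒divisible (i , j , k , l , i<j , j<k , k<l , uk<ul , ul<ui , ui<uj) with j <? u i
  ... | yes j<ui =
    twoLeave⇒divisible (i , j , i<j , (ℕ.<⇒≤ i<j , j<ui) , (ℕ.≤-refl , ℕ.<-trans j<ui ui<uj))
  ... | no j≮ui =
    twoEnter⇒divisible (k , l , k<l , (<⇒≤pred (ℕ.<-trans uk<ul ul<k) , <⇒pred< j<k) ,
                        (<⇒≤pred ul<k , ℕ.<-trans (<⇒pred< j<k) k<l))
    where
    ul<k : u l <ᶠ k
    ul<k = ℕ.<-≤-trans ul<ui (ℕ.≤-trans (ℕ.≮⇒≥ j≮ui) (ℕ.<⇒≤ j<k))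

proposition3p2 : (n : ℕ) (v w : Permutation′ n) → Divisible v w ⇔ (¬ Boolean (invMul v w))
proposition3p2 n v w = mk⇔
  (λ divisible (¬321 , ¬3412) → [ ¬321 , ¬3412 ] (divisible⇒321⊎3412 v w divisible))
  (λ ¬boolean → decidable-stable (divisible? v w) λ ¬divisible →
     ¬boolean (¬divisible ∘ 321⇒divisible v w , ¬divisible ∘ 3412⇒divisible v w))
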